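{- Let $\mathcal M=(W,W^\bot,\preccurlyeq,\sqsubseteq,V)$ be a bi-intuitionistic model, $\Sigma$ a set of formulas, and $\sim$ a $\Sigma$-bisimulation on $\mathcal M$ that is also an equivalence relation. Then: (1) if $\mathcal M$ is forth--up confluent, so is $\mathcal M/\!\sim$; (2) if $\mathcal M$ is back--up confluent, so is $\mathcal M/\!\sim$; (3) if $\mathcal M$ is upward linear, so is $\mathcal M/\!\sim$.
   Context: Language $\mathcal L$ over countably many propositional variables $\mathbb P$: $\varphi ::= p \mid \bot \mid \varphi\wedge\varphi\mid\varphi\vee\varphi\mid\varphi\to\varphi\mid\Diamond\varphi\mid\Box\varphi$. A bi-intuitionistic model $(W,W^\bot,\preccurlyeq,\sqsubseteq,V)$: $\preccurlyeq,\sqsubseteq$ preorders on $W$, $W^\bot\subseteq W$ closed upward under both, $V:\mathbb P\to2^W$ with each $V(p)$ $\preccurlyeq$-upward closed and containing $W^\bot$. Satisfaction: $w\models p$ iff $w\in V(p)$; $w\models\bot$ iff $w\in W^\bot$; $\wedge,\vee$ pointwise; $w\models\varphi\to\psi$ iff for all $v\succcurlyeq w$, $v\models\varphi$ implies $v\models\psi$; $w\models\Diamond\varphi$ iff for all $u\succcurlyeq w$ there is $v\sqsupseteq u$ with $v\models\varphi$; $w\models\Box\varphi$ iff for all $u,v$ with $w\preccurlyeq u\sqsubseteq v$, $v\models\varphi$. For a relation $R$ on $W$: forth--up confluent if $w\preccurlyeq w'$ and $w\mathrel R v$ imply some $v'$ with $v\preccurlyeq v'$, $w'\mathrel R v'$;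 back--up confluent if $w\mathrel R v\preccurlyeq v'$ implies some $w'$ with $w\preccurlyeq w'\mathrel R v'$. A model is forth--up/back--up confluent if $\sqsubseteq$ is; upward linear if $w\preccurlyeq u$, $w\preccurlyeq v$ imply $u\preccurlyeq v$ or $v\preccurlyeq u$. The $\Sigma$-label of $w$ is $\ell(w)=(\ell^+(w),\ell^\Diamond(w))$, $\ell^+(w)=\{\varphi\in\Sigma:w\models\varphi\}$, $\ell^\Diamond(w)=\{\varphi\in\Sigma:\forall v\,(w\sqsubseteq v\Rightarrow v\not\models\varphi)\}$. A $\Sigma$-bisimulation is a forth--up and back--up confluent $Z\subseteq W\times W$ with $w\mathrel Zv\Rightarrow\ell(w)=\ell(v)$. Quotient: for an equivalence relation $\sim$ with classes $[w]$, $\mathcal M/\!\sim=(W/\!\sim,W^\bot/\!\sim,\preccurlyeq/\!\sim,\sqsubseteq/\!\sim,V/\!\sim)$ where $W^\bot/\!\sim=\{[w]:w\in W^\bot\}$; $[w]\mathrel{\preccurlyeq/\!\sim}[v]$ iff some $w'\sim w$, $v'\sim v$ have $w'\preccurlyeq v'$; $\sqsubseteq/\!\sim$ is the transitive closure of the relation $[w]\sqsubseteq^0[v]$ iff some $w'\sim w$, $v'\sim v$ have $w'\sqsubseteq v'$; $V/\!\sim(p)=\{[w]:w\in V(p)\}$. -}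

module Defs where

open import Level using (Level; _⊔_; suc)
open import Data.Nat using (ℕ)
open import Data.Product using (Σ; ∃; ∃-syntax; _×_; _,_)
open import Data.Sum using (_⊎_)
open import Data.Empty using (⊥)
open import Relation.Nullary using (¬_)
open import Relation.Binary using (IsEquivalence)

data Formula : Set where
  var  : ℕ → Formula
  ⊥'   : Formula
  _∧'_ : Formula → Formula → Formula
  _∨'_ : Formula → Formula → Formula
  _⇒'_ : Formula → Formula → Formula
  ◇    : Formula → Formula
  □    : Formula → Formula

module _ {a r : Level} {A : Set a} where

  ForthUp : (_≼_ R : A → A → Set r) → Set (a ⊔ r)
  ForthUp _≼_ R = ∀ w w' v → w ≼ w' → R w v → ∃[ v' ] (v ≼ v' × R w' v')

  BackUp : (_≼_ R : A → A → Set r) → Set (a ⊔ r)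
  BackUp _≼_ R = ∀ w v v' → R w v → v ≼ v' → ∃[ w' ] (w ≼ w' × R w' v')

  UpwardLinear : (_≼_ : A → A → Set r) → Set (a ⊔ r)
  UpwardLinear _≼_ = ∀ w u v → w ≼ u → w ≼ v → (u ≼ v) ⊎ (v ≼ u)

record Model (a ℓ : Level) : Set (suc (a ⊔ ℓ)) where
  field
    W     : Set a
    Wbot  : W → Set ℓ
    _≼_   : W → W → Set ℓ
    _⊑_   : W → W → Set ℓ
    V     : ℕ → W → Set ℓ
    ≼-refl  : ∀ {w} → w ≼ w
    ≼-trans : ∀ {u v w} → u ≼ v → v ≼ w → u ≼ w
    ⊑-refl  : ∀ {w} → w ⊑ w
    ⊑-trans : ∀ {u v w} → u ⊑ v → v ⊑ w → u ⊑ w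
    Wbot-≼  : ∀ {w v} → Wbot w → w ≼ v → Wbot v
    Wbot-⊑  : ∀ {w v} → Wbot w → w ⊑ v → Wbot v
    V-≼     : ∀ p {w v} → V p w → w ≼ v → V p v
    Wbot-V  : ∀ p {w} → Wbot w → V p w

module _ {a ℓ : Level} (M : Model a ℓ) where
  open Model M

  _⊨_ : W → Formula → Set (a ⊔ ℓ)
  w ⊨ var p   = Level.Lift a (V p w)
  w ⊨ ⊥'      = Level.Lift a (Wbot w)
  w ⊨ (φ ∧' ψ) = (w ⊨ φ) × (w ⊨ ψ)
  w ⊨ (φ ∨' ψ) = (w ⊨ φ) ⊎ (w ⊨ ψ)
  w ⊨ (φ ⇒' ψ) = ∀ v → w ≼ v → v ⊨ φ → v ⊨ ψ
  w ⊨ ◇ φ      = ∀ u → w ≼ u → ∃[ v ] (u ⊑ v × v ⊨ φ)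
  w ⊨ □ φ      = ∀ u v → w ≼ u → u ⊑ v → v ⊨ φ

  -- φ ∈ ℓ^◇(w)  (membership in Σ handled separately)
  ◇Refuted : W → Formula → Set (a ⊔ ℓ)
  ◇Refuted w φ = ∀ v → w ⊑ v → ¬ (v ⊨ φ)

  SameLabel : {s : Level} → (Formula → Set s) → W → W → Set (a ⊔ ℓ ⊔ s)
  SameLabel Sig w v =
    (∀ φ → Sig φ → ((w ⊨ φ → v ⊨ φ) × (v ⊨ φ → w ⊨ φ))) ×
    (∀ φ → Sig φ → ((◇Refuted w φ → ◇Refuted v φ) × (◇Refuted v φ → ◇Refuted w φ)))

  record IsBisim {s : Level} (Sig : Formula → Set s) (Z : W → W → Set ℓ)
         : Set (a ⊔ ℓ ⊔ s) where
    field
      forthUp : ForthUp _≼_ Z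
      backUp  : BackUp _≼_ Z
      label   : ∀ w v → Z w v → SameLabel Sig w v

  ForthUpModel : Set (a ⊔ ℓ)
  ForthUpModel = ForthUp _≼_ _⊑_

  BackUpModel : Set (a ⊔ ℓ)
  BackUpModel = BackUp _≼_ _⊑_

  UpwardLinearModel : Set (a ⊔ ℓ)
  UpwardLinearModel = UpwardLinear _≼_

  -- The quotient M/~, represented on representatives: a class [w] is denoted
  -- by any w : W, and the lifted relations are ~-invariant by construction.
  module Quotient (_~_ : W → W → Set ℓ) where

    _≼q_ : W → W → Set (a ⊔ ℓ)
    w ≼q v = ∃[ w' ] ∃[ v' ] (w' ~ w × v' ~ v × w' ≼ v')

    _⊑⁰_ : W → W → Set (a ⊔ ℓ)
    w ⊑⁰ v = ∃[ w' ] ∃[ v' ] (w' ~ w × v' ~ v × w' ⊑ v')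

    data _⊑q_ : W → W → Set (a ⊔ ℓ) where
      [_]  : ∀ {w v} → w ⊑⁰ v → w ⊑q v
      _∷_  : ∀ {w u v} → w ⊑⁰ u → u ⊑q v → w ⊑q v

    ForthUpQ : Set (a ⊔ ℓ)
    ForthUpQ = ForthUp _≼q_ _⊑q_

    BackUpQ : Set (a ⊔ ℓ)
    BackUpQ = BackUp _≼q_ _⊑q_

    UpwardLinearQ : Set (a ⊔ ℓ)
    UpwardLinearQ = UpwardLinear _≼q_

-- That makes a ≼-step between
-- classes replayable from any representative of the source class, so every
-- quotient configuration can be pulled back to a configuration in M.  There
-- the assumed property applies, and the result is pushed back to the quotient.
-- For ⊑/~ this is done one ⊑⁰-step at a time and propagated along the chain.
module Submission where

open import Defs
open import Level using (Level)
open import Data.Product using (_×_; _,_; ∃-syntax)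
open import Data.Sum using (inj₁; inj₂)
open import Relation.Binary using (IsEquivalence)

module QuotientConfluence {a ℓ : Level} (M : Model a ℓ)
    (_~_ : Model.W M → Model.W M → Set ℓ) (~-isEquivalence : IsEquivalence _~_)
    (~-forthUp : ForthUp (Model._≼_ M) _~_) where

  open Model M
  open Quotient M _~_
  open IsEquivalence ~-isEquivalence renaming (refl to ~-refl; sym to ~-sym; trans to ~-trans)

  ≼q⇒≼-from : ∀ {w w' x} → w ≼q w' → x ~ w → ∃[ x' ] (x ≼ x' × x' ~ w')
  ≼q⇒≼-from {x = x} (u , u' , u~w , u'~w' , u≼u') x~w
    with ~-forthUp u u' x u≼u' (~-trans u~w (~-sym x~w))
  ... | x' , x≼x' , u'~x' = x' , x≼x' , ~-trans (~-sym u'~x') u'~w'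

  ⊑⁰-forthUp : ForthUpModel M → ∀ {w w' v} → w ≼q w' → w ⊑⁰ v →
               ∃[ v' ] (v ≼q v' × w' ⊑⁰ v')
  ⊑⁰-forthUp fu w≼w' (x , y , x~w , y~v , x⊑y) with ≼q⇒≼-from w≼w' x~w
  ... | x' , x≼x' , x'~w' with fu x x' y x≼x' x⊑y
  ... | y' , y≼y' , x'⊑y' =
    y' , (y , y' , y~v , ~-refl , y≼y') , (x' , y' , x'~w' , ~-refl , x'⊑y')

  ⊑q-forthUp : ForthUpModel M → ForthUpQ
  ⊑q-forthUp fu w w' v w≼w' [ w⊑v ] with ⊑⁰-forthUp fu w≼w' w⊑v
  ... | v' , v≼v' , w'⊑v' = v' , v≼v' , [ w'⊑v' ]
  ⊑q-forthUp fu w w' v w≼w' (_∷_ {u = u} w⊑u u⊑v) with ⊑⁰-forthUp fu w≼w' w⊑u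
  ... | u' , u≼u' , w'⊑u' with ⊑q-forthUp fu u u' v u≼u' u⊑v
  ... | v' , v≼v' , u'⊑v' = v' , v≼v' , (w'⊑u' ∷ u'⊑v')

  ⊑⁰-backUp : BackUpModel M → ∀ {w v v'} → w ⊑⁰ v → v ≼q v' →
              ∃[ w' ] (w ≼q w' × w' ⊑⁰ v')
  ⊑⁰-backUp bu (x , y , x~w , y~v , x⊑y) v≼v' with ≼q⇒≼-from v≼v' y~v
  ... | y' , y≼y' , y'~v' with bu x y y' x⊑y y≼y'
  ... | x' , x≼x' , x'⊑y' =
    x' , (x , x' , x~w , ~-refl , x≼x') , (x' , y' , ~-refl , y'~v' , x'⊑y')

  ⊑q-backUp : BackUpModel M → BackUpQ
  ⊑q-backUp bu w v v' [ w⊑v ] v≼v' with ⊑⁰-backUp bu w⊑v v≼v'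
  ... | w' , w≼w' , w'⊑v' = w' , w≼w' , [ w'⊑v' ]
  ⊑q-backUp bu w v v' (_∷_ {u = u} w⊑u u⊑v) v≼v' with ⊑q-backUp bu u v v' u⊑v v≼v'
  ... | u' , u≼u' , u'⊑v' with ⊑⁰-backUp bu w⊑u u≼u'
  ... | w' , w≼w' , w'⊑u' = w' , w≼w' , (w'⊑u' ∷ u'⊑v')

  ≼q-upwardLinear : UpwardLinearModel M → UpwardLinearQ
  ≼q-upwardLinear ul w u v w≼u (y , v' , y~w , v'~v , y≼v') with ≼q⇒≼-from w≼u y~w
  ... | u' , y≼u' , u'~u with ul y u' v' y≼u' y≼v'
  ... | inj₁ u'≼v' = inj₁ (u' , v' , u'~u , v'~v , u'≼v')
  ... | inj₂ v'≼u' = inj₂ (v' , u' , v'~v , u'~u , v'≼u')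

mainTheorem12 : {a ℓ s : Level} (M : Model a ℓ) (Sig : Formula → Set s)
    (_~_ : Model.W M → Model.W M → Set ℓ) →
    IsEquivalence _~_ → IsBisim M Sig _~_ →
    (ForthUpModel M → Quotient.ForthUpQ M _~_) ×
    (BackUpModel M → Quotient.BackUpQ M _~_) ×
    (UpwardLinearModel M → Quotient.UpwardLinearQ M _~_)
mainTheorem12 M Sig _~_ ~-isEquivalence bisim = ⊑q-forthUp , ⊑q-backUp , ≼q-upwardLinear
  where open QuotientConfluence M _~_ ~-isEquivalence (IsBisim.forthUp bisim)
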